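{- Let $p$ be a prime with $p \equiv 5 \pmod 8$, and let $a, b \in \mathbb{Z}$ satisfy $a^2 \equiv -1 \pmod p$ and $8ab^2 \equiv 1 \pmod p$. For an integer $y$ define \[ x = \pm b\, y^{\frac{p+3}{8}}\left(1+y^{\frac{p-1}{2}}\right)\left(a+y^{\frac{p-1}{4}}\right) \bmod p . \] If $y$ is a quadratic residue modulo $p$, then $x^2 \equiv y \pmod p$, and if $y$ is a quadratic nonresidue modulo $p$, then $x \equiv 0 \pmod p$.
   Context: Quadratic residues and nonresidues modulo the odd prime $p$ are the nonzero classes $y$ with $y^{\frac{p-1}{2}} \equiv 1$ and $y^{\frac{p-1}{2}} \equiv -1 \pmod p$ respectively (Euler's criterion). The aim is a polynomial in $y$ over $\mathbb{Z}_p$ which returns a square root of $y$ when $y$ is a quadratic residue and returns $0$ when $y$ is a quadratic nonresidue. -}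

module Defs where

open import Data.Nat as ℕ using (ℕ; _∸_)
open import Data.Nat.DivMod using (_/_)
open import Data.Integer using (ℤ; +_; -_; _-_; _*_; _+_; _^_)
open import Data.Integer.Divisibility using (_∣_)

_≡_[mod_] : ℤ → ℤ → ℕ → Set
u ≡ v [mod m ] = (+ m) ∣ (u - v)

-- quadratic residue / nonresidue modulo p, via Euler's criterion (as in the paper's context)
QR : ℕ → ℤ → Set
QR p y = (y ^ ((p ∸ 1) / 2)) ≡ (+ 1) [mod p ]

QNR : ℕ → ℤ → Set
QNR p y = (y ^ ((p ∸ 1) / 2)) ≡ (- (+ 1)) [mod p ]

-- the candidate square root, with sign s ∈ {1, -1}
xval : ℕ → ℤ → ℤ → ℤ → ℤ → ℤ
xval p s a b y =
  s * b * (y ^ ((p ℕ.+ 3) / 8)) * (+ 1 + y ^ ((p ∸ 1) / 2)) * (a + y ^ ((p ∸ 1) / 4))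

module Submission where

-- Write h = (p+3)/8, q = (p-1)/4, d = (p-1)/2 and put
-- Y = y^h, t = y^q, T = y^d, so that x = s·b·Y·(1+T)·(a+t).  Since p = 8k+5
-- we have h = k+1, q = 2k+1, d = 4k+2; hence, as exact integer identities,
--   T = t·t   and   Y·Y·t = y^(4k+3) = y·T.
-- If y is a residue (T ≡ 1), then x ≡ 2sbY(a+t) and, using a² ≡ -1, t² ≡ 1,
--   x² ≡ 4b²Y²(a² + 2at + t²) ≡ 8ab²·Y²t ≡ Y²t = yT ≡ y.
-- If y is a nonresidue (T ≡ -1), the factor 1+T kills x.

open import Defs
open import Data.Nat using (ℕ; _%_)
open import Data.Nat.DivMod using (_/_; m≡m%n+[m/n]*n; m*n/n≡m)
import Data.Nat.Tactic.RingSolver as ℕ-Solver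
open import Relation.Binary.PropositionalEquality
  using (_≡_; refl; sym; trans; cong; subst; module ≡-Reasoning)

module Exponents (p : ℕ) (p≡5 : p % 8 ≡ 5) where
  open import Data.Nat using (_+_; _*_; _∸_; NonZero)

  h q d : ℕ
  h = (p + 3) / 8
  q = (p ∸ 1) / 4
  d = (p ∸ 1) / 2

  k : ℕ
  k = p / 8

  p≡8k+5 : p ≡ 5 + k * 8
  p≡8k+5 = trans (m≡m%n+[m/n]*n p 8) (cong (_+ k * 8) p≡5)

  quotient : ∀ (f : ℕ → ℕ) m c .{{_ : NonZero c}} → f (5 + k * 8) ≡ m * c → f p / c ≡ m
  quotient f m c eq = trans (cong (λ p′ → f p′ / c) p≡8k+5) (trans (cong (_/ c) eq) (m*n/n≡m m c))

  h≡k+1 : h ≡ 1 + k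
  h≡k+1 = quotient (_+ 3) (1 + k) 8 (arith k)
    where
    arith : ∀ k → 5 + k * 8 + 3 ≡ (1 + k) * 8
    arith = ℕ-Solver.solve-∀

  q≡2k+1 : q ≡ 1 + k * 2
  q≡2k+1 = quotient (_∸ 1) (1 + k * 2) 4 (arith k)
    where
    arith : ∀ k → 4 + k * 8 ≡ (1 + k * 2) * 4
    arith = ℕ-Solver.solve-∀

  d≡4k+2 : d ≡ 2 + k * 4
  d≡4k+2 = quotient (_∸ 1) (2 + k * 4) 2 (arith k)
    where
    arith : ∀ k → 4 + k * 8 ≡ (2 + k * 4) * 2
    arith = ℕ-Solver.solve-∀

  d≡q+q : d ≡ q + q
  d≡q+q rewrite d≡4k+2 | q≡2k+1 = arith k
    where
    arith : ∀ k → 2 + k * 4 ≡ (1 + k * 2) + (1 + k * 2)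
    arith = ℕ-Solver.solve-∀

  2h+q≡1+d : h + h + q ≡ 1 + d
  2h+q≡1+d rewrite h≡k+1 | q≡2k+1 | d≡4k+2 = arith k
    where
    arith : ∀ k → (1 + k) + (1 + k) + (1 + k * 2) ≡ 1 + (2 + k * 4)
    arith = ℕ-Solver.solve-∀

-- Integer arithmetic is opened only now, so that the natural-number operators
-- above could be used unqualified.
open import Data.Nat.Primality using (Prime)
open import Data.Integer using (ℤ; +_; -_; _*_; _+_; _-_; _^_)
open import Data.Integer.Properties using (^-distribˡ-+-*; i≡j⇒i-j≡0)
open import Data.Integer.Divisibility.Signed
  using (_∣_; divides; ∣ᵤ⇒∣; ∣⇒∣ᵤ; ∣m∣n⇒∣m+n; ∣n⇒∣m*n)
open import Data.Integer.Tactic.RingSolver using (solve-∀)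
open import Data.Sum using (_⊎_; inj₁; inj₂)
open import Data.Product using (_×_; _,_)

infixl 6 _⊞_
infixl 7 _⊠_

_⊞_ : ∀ {n u v} → n ∣ u → n ∣ v → n ∣ u + v
_⊞_ = ∣m∣n⇒∣m+n

_⊠_ : ∀ {n} c {u} → n ∣ u → n ∣ c * u
_⊠_ = ∣n⇒∣m*n

≡⇒≡[mod] : ∀ {n u v} → u ≡ v → u ≡ v [mod n ]
≡⇒≡[mod] {n} u≡v = ∣⇒∣ᵤ {+ n} (subst (+ n ∣_) (sym (i≡j⇒i-j≡0 u≡v)) (divides (+ 0) refl))

sign-square : ∀ {s} → s ≡ + 1 ⊎ s ≡ - (+ 1) → s * s ≡ + 1
sign-square (inj₁ refl) = refl
sign-square (inj₂ refl) = refl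

-- The residue case as a polynomial identity: x² - y written as a combination of
-- the quantities s²-1, T-1, a²+1, t²-T, 8ab²-1 and Y²t-yT, all ≡ 0 (mod n).
-- It encodes  (1+T)² = 4 + (T+3)(T-1)  and  4(a+t)² = 4(a²+1) + 4(t²-T) + 4(T-1) + 8at.
square-decomposition : ∀ (s a b y Y t T : ℤ) →
  let W = b * Y * (+ 1 + T) * (a + t) in
  (s * b * Y * (+ 1 + T) * (a + t)) * (s * b * Y * (+ 1 + T) * (a + t)) - y ≡
    (W * W) * (s * s - + 1)
    + (b * b * Y * Y * (a + t) * (a + t) * (T + + 3)) * (T - + 1)
    + (+ 4 * b * b * Y * Y) * (a * a - - (+ 1))
    + (+ 4 * b * b * Y * Y) * (t * t - T)
    + (+ 4 * b * b * Y * Y) * (T - + 1)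
    + (Y * Y * t) * (+ 8 * a * (b * b) - + 1)
    + (Y * Y * t - y * T)
    + y * (T - + 1)
square-decomposition = solve-∀

root-of-residue : ∀ (n : ℕ) (s a b y Y t T : ℤ) →
  (s * s) ≡ + 1 [mod n ] → (a * a) ≡ - (+ 1) [mod n ] → (+ 8 * a * (b * b)) ≡ + 1 [mod n ] →
  T ≡ + 1 [mod n ] → (t * t) ≡ T [mod n ] → (Y * Y * t) ≡ (y * T) [mod n ] →
  ((s * b * Y * (+ 1 + T) * (a + t)) * (s * b * Y * (+ 1 + T) * (a + t))) ≡ y [mod n ]
root-of-residue n s a b y Y t T sign a² 8ab² T≡1 t² Y²t =
  ∣⇒∣ᵤ (subst (+ n ∣_) (sym (square-decomposition s a b y Y t T))
    ( (W * W) ⊠ ∣ᵤ⇒∣ sign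
    ⊞ (b * b * Y * Y * (a + t) * (a + t) * (T + + 3)) ⊠ ∣ᵤ⇒∣ T≡1
    ⊞ (+ 4 * b * b * Y * Y) ⊠ ∣ᵤ⇒∣ a²
    ⊞ (+ 4 * b * b * Y * Y) ⊠ ∣ᵤ⇒∣ t²
    ⊞ (+ 4 * b * b * Y * Y) ⊠ ∣ᵤ⇒∣ T≡1
    ⊞ (Y * Y * t) ⊠ ∣ᵤ⇒∣ 8ab²
    ⊞ ∣ᵤ⇒∣ Y²t
    ⊞ y ⊠ ∣ᵤ⇒∣ T≡1))
  where
  W : ℤ
  W = b * Y * (+ 1 + T) * (a + t)

vanishes-on-nonresidue : ∀ (n : ℕ) (s a b Y t T : ℤ) →
  T ≡ - (+ 1) [mod n ] → (s * b * Y * (+ 1 + T) * (a + t)) ≡ + 0 [mod n ]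
vanishes-on-nonresidue n s a b Y t T T≡-1 =
  ∣⇒∣ᵤ (subst (+ n ∣_) (sym (factor s a b Y t T)) ((s * b * Y * (a + t)) ⊠ ∣ᵤ⇒∣ T≡-1))
  where
  factor : ∀ (s a b Y t T : ℤ) →
    s * b * Y * (+ 1 + T) * (a + t) - + 0 ≡ (s * b * Y * (a + t)) * (T - - (+ 1))
  factor = solve-∀

module _ (y : ℤ) where
  open import Data.Nat using () renaming (_+_ to _+ℕ_)

  power-double : ∀ d q → d ≡ q +ℕ q → y ^ d ≡ y ^ q * y ^ q
  power-double d q refl = ^-distribˡ-+-* y q q

  power-shift : ∀ h q d → h +ℕ h +ℕ q ≡ 1 +ℕ d → y ^ h * y ^ h * y ^ q ≡ y * y ^ d
  power-shift h q d eq = begin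
    y ^ h * y ^ h * y ^ q  ≡⟨ cong (_* y ^ q) (^-distribˡ-+-* y h h) ⟨
    y ^ (h +ℕ h) * y ^ q   ≡⟨ ^-distribˡ-+-* y (h +ℕ h) q ⟨
    y ^ (h +ℕ h +ℕ q)      ≡⟨ cong (y ^_) eq ⟩
    y ^ (1 +ℕ d)           ∎
    where open ≡-Reasoning

theorem3 : (p : ℕ) → Prime p → p % 8 ≡ 5 →
    (a b : ℤ) → (a * a) ≡ - (+ 1) [mod p ] → (+ 8 * a * (b * b)) ≡ + 1 [mod p ] →
    (s : ℤ) → (s ≡ + 1 ⊎ s ≡ - (+ 1)) → (y : ℤ) →
      (QR p y → (xval p s a b y * xval p s a b y) ≡ y [mod p ])
      × (QNR p y → xval p s a b y ≡ + 0 [mod p ])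
theorem3 p _ p≡5 a b a² 8ab² s ±1 y =
    (λ residue → root-of-residue p s a b y Y t T
                   (≡⇒≡[mod] (sign-square ±1)) a² 8ab² residue
                   (≡⇒≡[mod] (sym (power-double y d q d≡q+q)))
                   (≡⇒≡[mod] (power-shift y h q d 2h+q≡1+d)))
  , vanishes-on-nonresidue p s a b Y t T
  where
  open Exponents p p≡5
  Y t T : ℤ
  Y = y ^ h
  t = y ^ q
  T = y ^ d
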